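{- Let $Y$ be a set and $\pi:Y\to I$ a surjective map onto a finite set $I$, and write $Y_i=\pi^{ -1}(i)$ for $i\in I$. Let $n\geq1$. (1) There is a natural decomposition \[ \mathrm{Map}(\mathbb{Z}_n,Y)/\mathbb{Z}_n=\bigsqcup_{d\mid n}\Big(\bigsqcup_{\alpha\in \mathrm{Map}(\mathbb{Z}_n,I)^{\{d\}}/\mathbb{Z}_d}\mathrm{Map}_\alpha(\mathbb{Z}_n,Y)/\mathbb{Z}_n\Big). \] (2) If $\alpha=[\beta,\dots,\beta]\in\mathrm{Map}(\mathbb{Z}_n,I)^{\{d\}}/\mathbb{Z}_d$, where $\beta=(\beta_1,\dots,\beta_d)$ is a $d$-tuple of elements of $I$ repeated $n/d$ times, then there is a bijection \[ \mathrm{Map}_\alpha(\mathbb{Z}_n,Y)/\mathbb{Z}_n\simeq (Y_{\beta_1}\times\dots\times Y_{\beta_d})^{n/d}/\mathbb{Z}_{n/d}, \] where $\mathbb{Z}_{n/d}$ acts on $(Y_{\beta_1}\times\dots\times Y_{\beta_d})^{n/d}$ by cyclic permutation of the $n/d$ factors.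
   Context: For a set $Z$, $\mathbb{Z}_n$ acts on $\mathrm{Map}(\mathbb{Z}_n,Z)$ by $(af)(b)=f(a+b)$. For a divisor $d$ of $n$, $\langle d\rangle\subseteq\mathbb{Z}_n$ is the subgroup generated by $d$, and for a $\mathbb{Z}_n$-set $X$, $X^{\{d\}}=\{x\in X:\mathrm{Stab}_{\mathbb{Z}_n}(x)=\langle d\rangle\}$, on which the action factors through $\mathbb{Z}_d$. For $g\in\mathrm{Map}(\mathbb{Z}_n,I)$, $\mathrm{Map}_g(\mathbb{Z}_n,Y)=\{f:\mathbb{Z}_n\to Y:\pi\circ f=g\}$, and for the orbit $[g]$ of $g$, $\mathrm{Map}_{[g]}(\mathbb{Z}_n,Y)=\bigcup_{a\in\mathbb{Z}_n}\mathrm{Map}_{ag}(\mathbb{Z}_n,Y)$, which is stable under $\mathbb{Z}_n$. For a necklace $\alpha=[g]$, $\mathrm{Map}_\alpha(\mathbb{Z}_n,Y)$ means $\mathrm{Map}_{[g]}(\mathbb{Z}_n,Y)$. The notation $[\gamma_1,\dots,\gamma_n]$ denotes the $\mathbb{Z}_n$-orbit of the map $k\mapsto\gamma_k$. -}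

module Defs where

open import Level using (Level)
open import Data.Nat using (ℕ; zero; suc; _+_; NonZero)
open import Data.Nat.DivMod using (_mod_; _%_; _/_)
open import Data.Nat.Divisibility using (_∣_)
open import Data.Fin using (Fin; toℕ)
open import Data.Product using (Σ; ∃; _×_; _,_; proj₁)
open import Relation.Binary.PropositionalEquality using (_≡_)
open import Function.Bundles using (_⇔_)

-- The cyclic group ℤ_n is modelled by Fin n (addition mod n).
-- Map(ℤ_n, Z) is modelled by functions Fin n → Z, compared pointwise.

addℤ : (n : ℕ) → ℕ → Fin n → Fin n
addℤ (suc k) a b = (a + toℕ b) mod (suc k)

act : {Z : Set} (n : ℕ) → ℕ → (Fin n → Z) → (Fin n → Z)
act n a f b = f (addℤ n a b)

_≐_ : {Z : Set} {n : ℕ} → (Fin n → Z) → (Fin n → Z) → Set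
f ≐ g = ∀ b → f b ≡ g b

Orb : {Z : Set} (n : ℕ) → (Fin n → Z) → (Fin n → Z) → Set
Orb n f g = ∃ λ (a : Fin n) → g ≐ act n (toℕ a) f

-- same ℤ_d-orbit, for the action of ℤ_d (factoring through ℤ_n → ℤ_d)
-- on maps whose stabiliser is ⟨d⟩: a ∈ ℤ_d acts as its lift toℕ a ∈ ℤ_n
OrbD : {Z : Set} (n d : ℕ) → (Fin n → Z) → (Fin n → Z) → Set
OrbD n d f g = ∃ λ (a : Fin d) → g ≐ act n (toℕ a) f

-- X^{d}: elements whose stabiliser in ℤ_n is exactly ⟨d⟩ = {a | d ∣ a}
HasStab : {Z : Set} (n d : ℕ) → (Fin n → Z) → Set
HasStab n d g = ∀ (a : Fin n) → (act n (toℕ a) g ≐ g) ⇔ (d ∣ toℕ a)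

-- Map_{[g]}(ℤ_n, Y) = ⋃_a Map_{a g}(ℤ_n, Y)
InMapOrb : {Y I : Set} (π : Y → I) (n : ℕ) → (Fin n → I) → (Fin n → Y) → Set
InMapOrb π n g f = ∃ λ (a : Fin n) → (λ b → π (f b)) ≐ act n (toℕ a) g

-- Part (1): the disjoint union  ⨆_{d ∣ n} ⨆_{α ∈ Map(ℤ_n,I)^{d}/ℤ_d} Map_α(ℤ_n,Y)/ℤ_n,
-- with elements represented by (d, g, f) and the equivalence
-- d = d', [g] = [g'] in X^{d}/ℤ_d, [f] = [f'] in Map_α/ℤ_n.

Piece : {Y I : Set} (π : Y → I) (n : ℕ) → Set
Piece {Y} {I} π n =
  Σ ℕ λ d → d ∣ n × (Σ (Fin n → I) λ g → HasStab n d g ×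
    Σ (Fin n → Y) λ f → InMapOrb π n g f)

pieceD : {Y I : Set} {π : Y → I} {n : ℕ} → Piece π n → ℕ
pieceD (d , _) = d

pieceG : {Y I : Set} {π : Y → I} {n : ℕ} → Piece π n → Fin n → I
pieceG (_ , _ , g , _) = g

pieceF : {Y I : Set} {π : Y → I} {n : ℕ} → Piece π n → Fin n → Y
pieceF (_ , _ , _ , _ , f , _) = f

PieceRel : {Y I : Set} (π : Y → I) (n : ℕ) → Piece π n → Piece π n → Set
PieceRel π n p q =
  pieceD {π = π} {n = n} p ≡ pieceD {π = π} {n = n} q
    × OrbD n (pieceD {π = π} {n = n} p) (pieceG {π = π} {n = n} p) (pieceG {π = π} {n = n} q)
    × Orb n (pieceF {π = π} {n = n} p) (pieceF {π = π} {n = n} q)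

incl : {Y I : Set} (π : Y → I) (n : ℕ) → Piece π n → Fin n → Y
incl π n = pieceF {π = π} {n = n}

-- Bijection between quotient sets A/~ and B/≈, given by representatives:
-- φ, ψ respect the relations and are mutually inverse up to the relations.

IsQuotInverse : {A B : Set} (_~_ : A → A → Set) (_≈_ : B → B → Set)
  → (A → B) → (B → A) → Set
IsQuotInverse _~_ _≈_ φ ψ =
  (∀ {x y} → x ~ y → φ x ≈ φ y) ×
  (∀ {x y} → x ≈ y → ψ x ~ ψ y) ×
  (∀ x → ψ (φ x) ~ x) ×
  (∀ y → φ (ψ y) ≈ y)

QuotBij : {A B : Set} (_~_ : A → A → Set) (_≈_ : B → B → Set) → Set
QuotBij {A} {B} _~_ _≈_ = Σ (A → B) λ φ → Σ (B → A) λ ψ → IsQuotInverse _~_ _≈_ φ ψ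

repeatβ : {I : Set} (n d : ℕ) .{{_ : NonZero d}} → (Fin d → I) → Fin n → I
repeatβ n d β k = β (toℕ k mod d)

MapOrb : {Y I : Set} (π : Y → I) (n : ℕ) → (Fin n → I) → Set
MapOrb {Y} π n g = Σ (Fin n → Y) λ f → InMapOrb π n g f

MapOrbRel : {Y I : Set} (π : Y → I) (n : ℕ) (g : Fin n → I)
  → MapOrb π n g → MapOrb π n g → Set
MapOrbRel π n g x y = Orb n (proj₁ x) (proj₁ y)

Fiber : {Y I : Set} (π : Y → I) → I → Set
Fiber {Y} π i = Σ Y λ y → π y ≡ i

-- (Y_{β_1} × … × Y_{β_d})^e, as e-tuples of d-tuples
Prod : {Y I : Set} (π : Y → I) (d e : ℕ) (β : Fin d → I) → Set
Prod π d e β = Fin e → (j : Fin d) → Fiber π (β j)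

rotProd : {Y I : Set} {π : Y → I} {d e : ℕ} {β : Fin d → I}
  → ℕ → Prod π d e β → Prod π d e β
rotProd {e = e} c h k = h (addℤ e c k)

EqP : {Y I : Set} (π : Y → I) (d e : ℕ) (β : Fin d → I)
  → Prod π d e β → Prod π d e β → Set
EqP π d e β h h' = ∀ k j → proj₁ (h k j) ≡ proj₁ (h' k j)

ProdRel : {Y I : Set} (π : Y → I) (d e : ℕ) (β : Fin d → I)
  → Prod π d e β → Prod π d e β → Set
ProdRel π d e β h h' = ∃ λ (c : Fin e) → EqP π d e β h' (rotProd {π = π} {d = d} {e = e} {β = β} (toℕ c) h)

-- A map F : ℤ_n → Z is studied through its periodic extension
-- ext F x = F (x mod n) on ℕ: translation by a becomes x ↦ a + x, and a fixes F
-- exactly when a is a period of ext F.  Periods are closed under sums, multiples,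
-- differences and reduction modulo another period, and are shared by all members of
-- an orbit.  When Z has decidable equality, searching 1 … n for the least positive
-- period produces the fundamental period d of F: the periods are precisely the
-- multiples of d.  This is the same as saying Stab(F) = ⟨d⟩ (and then d ∣ n).
--
-- Part (1): f is sent to the piece (d, π ∘ f, f) with d the fundamental period of
-- π ∘ f; d is an orbit invariant, and for a piece (d, g, f) the maps g and π ∘ f lie
-- in one orbit, so they have the same fundamental period d.
-- Part (2): for g = [β, …, β] with Stab(g) = ⟨d⟩ and n = e·d, an f ∈ Map_[g] is first
-- translated into Map_g, then cut into e consecutive blocks of length d; conversely a
-- tuple of blocks is concatenated.  Two normalised maps in one orbit differ by a
-- translation t that is a period of g, so t = q·d: a rotation of the blocks by q.
module Submission where

open import Defs
open import Data.Nat using (ℕ; zero; suc; _+_; _*_; _≤_; _<_; s<s⁻¹; NonZero; ≢-nonZero; _/_; _%_)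
open import Data.Nat.Properties
  using (+-assoc; +-comm; +-identityʳ; *-zeroʳ; *-distribʳ-+; ≮⇒≥; <⇒≱; 0≢1+n; m≤n⇒m<n∨m≡n)
open import Data.Nat.DivMod
open import Data.Nat.Divisibility
  using (_∣_; divides; ∣-refl; ∣-antisym; ∣⇒≤; 0∣⇒≡0; m%n≡0⇒n∣m; n∣m*n; ∣n∣m%n⇒∣m)
open import Data.Nat.Tactic.RingSolver using (solve-∀)
open import Data.Fin using (Fin; toℕ; fromℕ; fromℕ<) renaming (zero to zeroᶠ)
open import Data.Fin.Properties
  using (toℕ-injective; toℕ<n; toℕ-fromℕ; toℕ-fromℕ<; toℕ-inject; all?; ¬∀⟶∃¬-smallest)
  renaming (_≟_ to _≟ᶠ_)
open import Data.Product using (Σ; ∃; _×_; _,_; proj₁; proj₂)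
open import Data.Sum using (inj₁; inj₂)
open import Function using (_∘_)
open import Function.Bundles using (mk⇔; Equivalence)
open import Relation.Binary.Definitions using (DecidableEquality)
open import Relation.Binary.PropositionalEquality
  using (_≡_; refl; sym; trans; cong; cong₂; subst; module ≡-Reasoning)
open import Relation.Nullary using (Dec; ¬_; ¬?; contradiction)
open import Relation.Nullary.Decidable using (map′; decidable-stable)

toℕ-mod : ∀ x n .{{_ : NonZero n}} → toℕ (x mod n) ≡ x % n
toℕ-mod x n = toℕ-fromℕ< (m%n<n x n)

mod-cong : ∀ {x y} n .{{_ : NonZero n}} → x % n ≡ y % n → x mod n ≡ y mod n
mod-cong {x} {y} n eq = toℕ-injective (trans (toℕ-mod x n) (trans eq (sym (toℕ-mod y n))))

toℕ-mod-self : ∀ {n} .{{_ : NonZero n}} (b : Fin n) → toℕ b mod n ≡ b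
toℕ-mod-self {n} b = toℕ-injective (trans (toℕ-mod (toℕ b) n) (m<n⇒m%n≡m (toℕ<n b)))

[m+n%d]%d≡[m+n]%d : ∀ m n d .{{_ : NonZero d}} → (m + n % d) % d ≡ (m + n) % d
[m+n%d]%d≡[m+n]%d m n d = begin
  (m + n % d) % d           ≡⟨ %-distribˡ-+ m (n % d) d ⟩
  (m % d + n % d % d) % d   ≡⟨ cong (λ u → (m % d + u) % d) (m%n%n≡m%n n d) ⟩
  (m % d + n % d) % d       ≡⟨ %-distribˡ-+ m n d ⟨
  (m + n) % d               ∎
  where open ≡-Reasoning

toℕ-addℤ : ∀ n .{{_ : NonZero n}} a (b : Fin n) → toℕ (addℤ n a b) ≡ (a + toℕ b) % n
toℕ-addℤ (suc n') a b = toℕ-mod (a + toℕ b) (suc n')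

toℕ-addℤ-mod : ∀ n .{{_ : NonZero n}} a (b : Fin n) → toℕ (addℤ n (toℕ (a mod n)) b) ≡ (a + toℕ b) % n
toℕ-addℤ-mod n a b = begin
  toℕ (addℤ n (toℕ (a mod n)) b) ≡⟨ toℕ-addℤ n (toℕ (a mod n)) b ⟩
  (toℕ (a mod n) + toℕ b) % n    ≡⟨ cong (λ u → (u + toℕ b) % n) (toℕ-mod a n) ⟩
  (a % n + toℕ b) % n            ≡⟨ cong (_% n) (+-comm (a % n) (toℕ b)) ⟩
  (toℕ b + a % n) % n            ≡⟨ [m+n%d]%d≡[m+n]%d (toℕ b) a n ⟩
  (toℕ b + a) % n                ≡⟨ cong (_% n) (+-comm (toℕ b) a) ⟩
  (a + toℕ b) % n                ∎
  where open ≡-Reasoning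

-- Translating by c and then by n·c is translating by c·(1 + n).
c+[n*c+x]≡x+c*[1+n] : ∀ n c x → c + (n * c + x) ≡ x + c * suc n
c+[n*c+x]≡x+c*[1+n] = solve-∀

-- Carrying q·e blocks of length d out of a block index.
[p+q*e]*d+j≡p*d+j+q*[e*d] : ∀ p q e d j → (p + q * e) * d + j ≡ (p * d + j) + q * (e * d)
[p+q*e]*d+j≡p*d+j+q*[e*d] = solve-∀

-- Periodic extension, periods and the fundamental period of a map ℤ_N → Z.

module _ {n' : ℕ} where
  private
    N : ℕ
    N = suc n'

  ext : {Z : Set} → (Fin N → Z) → ℕ → Z
  ext F x = F (x mod N)

  ext-cong : {Z : Set} (F : Fin N → Z) (x y : ℕ) → x % N ≡ y % N → ext F x ≡ ext F y
  ext-cong F x y eq = cong F (mod-cong {x} {y} N eq)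

  ext-toℕ : {Z : Set} (F : Fin N → Z) (b : Fin N) → F b ≡ ext F (toℕ b)
  ext-toℕ F b = cong F (sym (toℕ-mod-self b))

  ext-+*N : {Z : Set} (F : Fin N → Z) (x k : ℕ) → ext F (x + k * N) ≡ ext F x
  ext-+*N F x k = ext-cong F (x + k * N) x ([m+kn]%n≡m%n x k N)

  ext-act : {Z : Set} (F : Fin N → Z) (a x : ℕ) → ext (act N a F) x ≡ ext F (a + x)
  ext-act F a x = ext-cong F (a + toℕ (x mod N)) (a + x)
    (trans (cong (λ u → (a + u) % N) (toℕ-mod x N)) ([m+n%d]%d≡[m+n]%d a x N))

  ext-≐ : {Z : Set} {F G : Fin N → Z} → F ≐ G → ∀ x → ext F x ≡ ext G x
  ext-≐ p x = p (x mod N)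

  ≐-ext : {Z : Set} {F G : Fin N → Z} → (∀ x → ext F x ≡ ext G x) → F ≐ G
  ≐-ext {F = F} {G} p b = trans (ext-toℕ F b) (trans (p (toℕ b)) (sym (ext-toℕ G b)))

  ext-orbit : {Z : Set} (F : Fin N → Z) {G : Fin N → Z} (c : ℕ)
    → G ≐ act N c F → ∀ x → ext G x ≡ ext F (c + x)
  ext-orbit F c p x = trans (ext-≐ p x) (ext-act F c x)

  -- The orbit relation is symmetric: translation by n'·c undoes translation by c.
  act-inverse : {Z : Set} (F : Fin N → Z) {G : Fin N → Z} (c : ℕ)
    → G ≐ act N c F → F ≐ act N (n' * c) G
  act-inverse F {G} c p = ≐-ext λ x → sym (begin
    ext (act N (n' * c) G) x      ≡⟨ ext-act G (n' * c) x ⟩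
    ext G (n' * c + x)            ≡⟨ ext-orbit F c p (n' * c + x) ⟩
    ext F (c + (n' * c + x))      ≡⟨ cong (ext F) (c+[n*c+x]≡x+c*[1+n] n' c x) ⟩
    ext F (x + c * N)             ≡⟨ ext-+*N F x c ⟩
    ext F x                       ∎)
    where open ≡-Reasoning

  record IsPeriod {Z : Set} (F : Fin N → Z) (a : ℕ) : Set where
    constructor period
    field shift : ∀ x → ext F (a + x) ≡ ext F x
  open IsPeriod public

  fixed⇒period : {Z : Set} {F : Fin N → Z} {a : ℕ} → act N a F ≐ F → IsPeriod F a
  fixed⇒period {F = F} {a} p = period λ x → trans (sym (ext-act F a x)) (ext-≐ p x)

  period⇒fixed : {Z : Set} {F : Fin N → Z} {a : ℕ} → IsPeriod F a → act N a F ≐ F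
  period⇒fixed {F = F} {a} p b = trans (shift p (toℕ b)) (sym (ext-toℕ F b))

  period? : {Z : Set} → DecidableEquality Z → (F : Fin N → Z) (a : ℕ) → Dec (IsPeriod F a)
  period? _≟_ F a = map′ fixed⇒period period⇒fixed (all? λ b → act N a F b ≟ F b)

  period-N : {Z : Set} {F : Fin N → Z} → IsPeriod F N
  period-N {F = F} = period λ x →
    ext-cong F (N + x) x (trans (cong (_% N) (+-comm N x)) ([m+n]%n≡m%n x N))

  period-+ : {Z : Set} {F : Fin N → Z} {a b : ℕ} → IsPeriod F a → IsPeriod F b → IsPeriod F (a + b)
  period-+ {F = F} {a} {b} pa pb = period λ x →
    trans (cong (ext F) (+-assoc a b x)) (trans (shift pa (b + x)) (shift pb x))

  period-* : {Z : Set} {F : Fin N → Z} {a : ℕ} (k : ℕ) → IsPeriod F a → IsPeriod F (k * a)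
  period-* zero    pa = period λ x → refl
  period-* (suc k) pa = period-+ pa (period-* k pa)

  period-cancel : {Z : Set} {F : Fin N → Z} {a b : ℕ} → IsPeriod F a → IsPeriod F (a + b) → IsPeriod F b
  period-cancel {F = F} {a} {b} pa pab = period λ x →
    trans (sym (shift pa (b + x))) (trans (cong (ext F) (sym (+-assoc a b x))) (shift pab x))

  period-% : {Z : Set} {F : Fin N → Z} {d a : ℕ} .{{_ : NonZero d}}
    → IsPeriod F d → IsPeriod F a → IsPeriod F (a % d)
  period-% {F = F} {d} {a} pd pa = period-cancel (period-* (a / d) pd)
    (subst (IsPeriod F) (trans (m≡m%n+[m/n]*n a d) (+-comm (a % d) (a / d * d))) pa)

  period-act : {Z : Set} {F G : Fin N → Z} {a : ℕ} (c : ℕ)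
    → G ≐ act N c F → IsPeriod F a → IsPeriod G a
  period-act {F = F} {G} {a} c p pa = period λ x → begin
    ext G (a + x)             ≡⟨ ext-orbit F c p (a + x) ⟩
    ext F (c + (a + x))       ≡⟨ cong (ext F) (swap c a x) ⟩
    ext F (a + (c + x))       ≡⟨ shift pa (c + x) ⟩
    ext F (c + x)             ≡⟨ ext-orbit F c p x ⟨
    ext G x                   ∎
    where
    open ≡-Reasoning
    swap : ∀ c a x → c + (a + x) ≡ a + (c + x)
    swap c a x = trans (sym (+-assoc c a x)) (trans (cong (_+ x) (+-comm c a)) (+-assoc a c x))

  act-mod-period : {Z : Set} {G : Fin N → Z} {d : ℕ} .{{_ : NonZero d}}
    → IsPeriod G d → ∀ c → act N c G ≐ act N (toℕ (c mod d)) G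
  act-mod-period {G = G} {d} pd c b = begin
    ext G (c + x)                     ≡⟨ cong (λ u → ext G (u + x)) c≡[c/d]*d+c%d ⟩
    ext G (c / d * d + c % d + x)     ≡⟨ cong (ext G) (+-assoc (c / d * d) (c % d) x) ⟩
    ext G (c / d * d + (c % d + x))   ≡⟨ shift (period-* (c / d) pd) (c % d + x) ⟩
    ext G (c % d + x)                 ≡⟨ cong (λ u → ext G (u + x)) (toℕ-mod c d) ⟨
    ext G (toℕ (c mod d) + x)         ∎
    where
    open ≡-Reasoning
    x = toℕ b
    c≡[c/d]*d+c%d : c ≡ c / d * d + c % d
    c≡[c/d]*d+c%d = trans (m≡m%n+[m/n]*n c d) (+-comm (c % d) (c / d * d))

  record FundamentalPeriod {Z : Set} (F : Fin N → Z) (d : ℕ) : Set where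
    field
      {{nonZero}} : NonZero d
      isPeriod    : IsPeriod F d
      divides-all : ∀ {a} → IsPeriod F a → d ∣ a

  -- Any least positive period is fundamental: the remainder modulo it is a smaller period.
  least⇒fundamental : {Z : Set} {F : Fin N → Z} {d′ : ℕ}
    → IsPeriod F (suc d′) → (∀ a → IsPeriod F (suc a) → d′ ≤ a) → FundamentalPeriod F (suc d′)
  least⇒fundamental {F = F} {d′} pd least = record { isPeriod = pd ; divides-all = λ {a} → dvd a }
    where
    dvd : ∀ a → IsPeriod F a → suc d′ ∣ a
    dvd a pa with a % suc d′ in eq | period-% {d = suc d′} pd pa
    ... | zero  | _ = m%n≡0⇒n∣m a (suc d′) eq
    ... | suc i | pi = contradiction (least i pi) (<⇒≱ (s<s⁻¹ (subst (_< suc d′) eq (m%n<n a (suc d′)))))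

  -- A map with decidable-equality values has a fundamental period: the least i such that
  -- suc i is a period is found as the least i where "suc i is not a period" fails (i = n'
  -- always qualifies, since N is a period).
  fundamentalPeriod : {Z : Set} → DecidableEquality Z → (F : Fin N → Z) → ∃ (FundamentalPeriod F)
  fundamentalPeriod _≟_ F
    with i , ¬¬pi , below ← ¬∀⟶∃¬-smallest N (λ i → ¬ IsPeriod F (suc (toℕ i)))
                              (λ i → ¬? (period? _≟_ F _))
                              (λ none → none (fromℕ n') (subst (IsPeriod F ∘ suc) (sym (toℕ-fromℕ n')) period-N))
    = suc (toℕ i) , least⇒fundamental (decidable-stable (period? _≟_ F _) ¬¬pi) least
    where
    least : ∀ a → IsPeriod F (suc a) → toℕ i ≤ a
    least a pa = ≮⇒≥ λ a<i → below (fromℕ< a<i)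
      (subst (IsPeriod F ∘ suc) (sym (trans (toℕ-inject (fromℕ< a<i)) (toℕ-fromℕ< a<i))) pa)

  fundamental-orbit : {Z : Set} {F G : Fin N → Z} {d d′ : ℕ} (c : ℕ) → G ≐ act N c F
    → FundamentalPeriod F d → FundamentalPeriod G d′ → d ≡ d′
  fundamental-orbit {F = F} c p fpF fpG = ∣-antisym
    (divides-all fpF (period-act (n' * c) (act-inverse F c p) (isPeriod fpG)))
    (divides-all fpG (period-act c p (isPeriod fpF)))
    where open FundamentalPeriod

  module _ {Z : Set} {F : Fin N → Z} {d : ℕ} (fp : FundamentalPeriod F d) where
    open FundamentalPeriod fp

    fundamental-∣N : d ∣ N
    fundamental-∣N = divides-all period-N

    fundamental⇒stab : HasStab N d F
    fundamental⇒stab a = mk⇔ (divides-all ∘ fixed⇒period) λ { (divides q eq) →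
      period⇒fixed (subst (IsPeriod F) (sym eq) (period-* q isPeriod)) }

  stab⇒fundamental : {Z : Set} {F : Fin N → Z} {d : ℕ} → HasStab N d F → d ∣ N → FundamentalPeriod F d
  stab⇒fundamental {F = F} {d} hs d∣N = record
    { nonZero = nonZero ; isPeriod = d-period ; divides-all = λ {a} → dvd a }
    where
    nonZero : NonZero d
    nonZero = ≢-nonZero λ { refl → 0≢1+n (sym (0∣⇒≡0 d∣N)) }
    fixed-below : ∀ {a} (a<N : a < N) → IsPeriod F a → d ∣ a
    fixed-below a<N pa = subst (d ∣_) (toℕ-fromℕ< a<N)
      (Equivalence.to (hs (fromℕ< a<N)) (period⇒fixed (subst (IsPeriod F) (sym (toℕ-fromℕ< a<N)) pa)))
    d-period : IsPeriod F d
    d-period with m≤n⇒m<n∨m≡n (∣⇒≤ d∣N)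
    ... | inj₂ refl = period-N
    ... | inj₁ d<N = subst (IsPeriod F) (toℕ-fromℕ< d<N)
          (fixed⇒period (Equivalence.from (hs (fromℕ< d<N)) (subst (d ∣_) (sym (toℕ-fromℕ< d<N)) ∣-refl)))
    dvd : ∀ a → IsPeriod F a → d ∣ a
    dvd a pa = ∣n∣m%n⇒∣m d∣N (fixed-below (m%n<n a N) (period-% period-N pa))

module Decomposition {Y : Set} {m : ℕ} (π : Y → Fin m) (n' : ℕ) where
  private
    N : ℕ
    N = suc n'

  shape : (Fin N → Y) → Fin N → Fin m
  shape f b = π (f b)

  period-of : (f : Fin N → Y) → ∃ (FundamentalPeriod (shape f))
  period-of f = fundamentalPeriod _≟ᶠ_ (shape f)

  orb-refl : {Z : Set} (f : Fin N → Z) → Orb N f f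
  orb-refl f = zeroᶠ , ext-toℕ f

  classify : (Fin N → Y) → Piece π N
  classify f = d , fundamental-∣N fp , shape f , fundamental⇒stab fp , f , zeroᶠ , ext-toℕ (shape f)
    where
    d = proj₁ (period-of f)
    fp = proj₂ (period-of f)

  classify-resp : ∀ {f f′} → Orb N f f′ → PieceRel π N (classify f) (classify f′)
  classify-resp {f} {f′} (c , p) =
    fundamental-orbit (toℕ c) shape-orbit (proj₂ (period-of f)) (proj₂ (period-of f′)) ,
    (toℕ c mod d , λ b → trans (shape-orbit b) (act-mod-period isPeriod (toℕ c) b)) ,
    (c , p)
    where
    d = proj₁ (period-of f)
    open FundamentalPeriod (proj₂ (period-of f))
    shape-orbit : shape f′ ≐ act N (toℕ c) (shape f)
    shape-orbit b = cong π (p b)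

  classify-incl : ∀ x → PieceRel π N (classify (incl π N x)) x
  classify-incl (d , d∣N , g , hs , f , a , p) =
    sym (fundamental-orbit (toℕ a) p (stab⇒fundamental hs d∣N) fpf) ,
    ((n' * toℕ a) mod d′ ,
      λ b → trans (act-inverse g (toℕ a) p b) (act-mod-period isPeriod (n' * toℕ a) b)) ,
    orb-refl f
    where
    d′ = proj₁ (period-of f)
    fpf = proj₂ (period-of f)
    open FundamentalPeriod fpf

  bijection : Σ ((Fin N → Y) → Piece π N) λ ψ → IsQuotInverse (PieceRel π N) (Orb N) (incl π N) ψ
  bijection = classify , (λ r → proj₂ (proj₂ r)) , classify-resp , classify-incl , orb-refl

-- Part (2): the piece over [β, …, β] is the set of e-tuples of blocks of length d, N = e·d.

module Blocks {Y : Set} {m : ℕ} (π : Y → Fin m) (n' d : ℕ) .{{_ : NonZero d}} (d∣N : d ∣ suc n')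
  (β : Fin d → Fin m) (hs : HasStab (suc n') d (repeatβ (suc n') d β)) where
  private
    N : ℕ
    N = suc n'

  e : ℕ
  e = N / d

  e*d≡N : e * d ≡ N
  e*d≡N = m/n*n≡m d∣N

  instance
    e-nonZero : NonZero e
    e-nonZero = ≢-nonZero λ e≡0 → 0≢1+n (trans (cong (_* d) (sym e≡0)) e*d≡N)

    e*d-nonZero : NonZero (e * d)
    e*d-nonZero = subst NonZero (sym e*d≡N) _

  row : ℕ → Fin e
  row x = (x / d) mod e

  col : ℕ → Fin d
  col x = x mod d

  point : ℕ → Fin d → ℕ
  point k j = k * d + toℕ j

  row-%N : ∀ x → row (x % N) ≡ row x
  row-%N x = mod-cong e (begin
    x % N / d % e         ≡⟨ cong (λ u → u / d % e) (%-congʳ {o = x} (sym e*d≡N)) ⟩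
    x % (e * d) / d % e   ≡⟨ cong (_% e) (m%[n*o]/o≡m/o%n x e d) ⟩
    x / d % e % e         ≡⟨ m%n%n≡m%n (x / d) e ⟩
    x / d % e             ∎)
    where open ≡-Reasoning

  col-%N : ∀ x → col (x % N) ≡ col x
  col-%N x = mod-cong d (m∣n⇒o%n%m≡o%m d N x d∣N)

  row-mod-N : ∀ x → row (toℕ (x mod N)) ≡ row x
  row-mod-N x = trans (cong row (toℕ-mod x N)) (row-%N x)

  col-mod-N : ∀ x → col (toℕ (x mod N)) ≡ col x
  col-mod-N x = trans (cong col (toℕ-mod x N)) (col-%N x)

  /-shift : ∀ c x → (c * d + x) / d ≡ c + x / d
  /-shift c x = trans (+-distrib-/-∣ˡ x (n∣m*n c)) (cong (_+ x / d) (m*n/n≡m c d))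

  row-shift : ∀ c x → row (c * d + x) ≡ addℤ e c (row x)
  row-shift c x = toℕ-injective (begin
    toℕ (row (c * d + x))         ≡⟨ toℕ-mod ((c * d + x) / d) e ⟩
    (c * d + x) / d % e           ≡⟨ cong (_% e) (/-shift c x) ⟩
    (c + x / d) % e               ≡⟨ [m+n%d]%d≡[m+n]%d c (x / d) e ⟨
    (c + x / d % e) % e           ≡⟨ cong (λ u → (c + u) % e) (toℕ-mod (x / d) e) ⟨
    (c + toℕ (row x)) % e         ≡⟨ toℕ-addℤ e c (row x) ⟨
    toℕ (addℤ e c (row x))        ∎)
    where open ≡-Reasoning

  col-shift : ∀ c x → col (c * d + x) ≡ col x
  col-shift c x = mod-cong d (%-remove-+ˡ x (n∣m*n c))

  row-point : (k : Fin e) (j : Fin d) → row (point (toℕ k) j) ≡ k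
  row-point k j = trans (mod-cong e (cong (_% e) block-index)) (toℕ-mod-self k)
    where
    block-index : point (toℕ k) j / d ≡ toℕ k
    block-index = trans (/-shift (toℕ k) (toℕ j))
      (trans (cong (toℕ k +_) (m<n⇒m/n≡0 (toℕ<n j))) (+-identityʳ (toℕ k)))

  col-point : ∀ k (j : Fin d) → col (point k j) ≡ j
  col-point k j = trans (col-shift k (toℕ j)) (toℕ-mod-self j)

  row-translate : ∀ c (b : Fin N) → row (toℕ (addℤ N (toℕ ((c * d) mod N)) b)) ≡ addℤ e c (row (toℕ b))
  row-translate c b =
    trans (cong row (toℕ-addℤ-mod N (c * d) b)) (trans (row-%N (c * d + toℕ b)) (row-shift c (toℕ b)))

  col-translate : ∀ c (b : Fin N) → col (toℕ (addℤ N (toℕ ((c * d) mod N)) b)) ≡ col (toℕ b)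
  col-translate c b =
    trans (cong col (toℕ-addℤ-mod N (c * d) b)) (trans (col-%N (c * d + toℕ b)) (col-shift c (toℕ b)))

  ext-point-mod : {Z : Set} (F : Fin N → Z) (r : ℕ) (j : Fin d)
    → ext F (point (r % e) j) ≡ ext F (point r j)
  ext-point-mod F r j = sym (begin
    ext F (point r j)                              ≡⟨ cong (λ u → ext F (point u j)) (m≡m%n+[m/n]*n r e) ⟩
    ext F ((r % e + r / e * e) * d + toℕ j)        ≡⟨ cong (ext F) (carry (r % e) (r / e)) ⟩
    ext F (point (r % e) j + r / e * (e * d))      ≡⟨ cong (λ u → ext F (point (r % e) j + r / e * u)) e*d≡N ⟩
    ext F (point (r % e) j + r / e * N)            ≡⟨ ext-+*N F (point (r % e) j) (r / e) ⟩
    ext F (point (r % e) j)                        ∎)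
    where
    open ≡-Reasoning
    carry : ∀ p q → (p + q * e) * d + toℕ j ≡ point p j + q * (e * d)
    carry p q = [p+q*e]*d+j≡p*d+j+q*[e*d] p q e d (toℕ j)

  ext-coords : {Z : Set} (F : Fin N → Z) (x : ℕ) → ext F (point (toℕ (row x)) (col x)) ≡ ext F x
  ext-coords F x = begin
    ext F (point (toℕ (row x)) (col x))   ≡⟨ cong (λ u → ext F (point u (col x))) (toℕ-mod (x / d) e) ⟩
    ext F (point (x / d % e) (col x))     ≡⟨ ext-point-mod F (x / d) (col x) ⟩
    ext F (x / d * d + toℕ (col x))       ≡⟨ cong (λ v → ext F (x / d * d + v)) (toℕ-mod x d) ⟩
    ext F (x / d * d + x % d)             ≡⟨ cong (ext F) (trans (+-comm (x / d * d) (x % d)) (sym (m≡m%n+[m/n]*n x d))) ⟩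
    ext F x                               ∎
    where open ≡-Reasoning

  ext-rotate : {Z : Set} (F : Fin N → Z) (q : ℕ) (k : Fin e) (j : Fin d)
    → ext F (q * d + point (toℕ k) j) ≡ ext F (point (toℕ (addℤ e (toℕ (q mod e)) k)) j)
  ext-rotate F q k j = begin
    ext F (q * d + point (toℕ k) j)                   ≡⟨ cong (ext F) blocks-add ⟩
    ext F (point (q + toℕ k) j)                       ≡⟨ ext-point-mod F (q + toℕ k) j ⟨
    ext F (point ((q + toℕ k) % e) j)                 ≡⟨ cong (λ u → ext F (point u j)) (toℕ-addℤ-mod e q k) ⟨
    ext F (point (toℕ (addℤ e (toℕ (q mod e)) k)) j)  ∎
    where
    open ≡-Reasoning
    blocks-add : q * d + (toℕ k * d + toℕ j) ≡ (q + toℕ k) * d + toℕ j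
    blocks-add = trans (sym (+-assoc (q * d) (toℕ k * d) (toℕ j)))
      (cong (_+ toℕ j) (sym (*-distribʳ-+ d q (toℕ k))))

  rotate-zero : (k : Fin e) → addℤ e (toℕ (0 mod e)) k ≡ k
  rotate-zero k = toℕ-injective (trans (toℕ-addℤ-mod e 0 k) (m<n⇒m%n≡m (toℕ<n k)))

  g : Fin N → Fin m
  g = repeatβ N d β

  ext-g : ∀ x → ext g x ≡ β (col x)
  ext-g x = cong β (col-mod-N x)

  -- A translation relating two maps over g is a period of g, hence a multiple of d.
  over-g-translation : {F F′ : Fin N → Y} (t : ℕ) → (∀ z → π (ext F z) ≡ ext g z)
    → (∀ z → π (ext F′ z) ≡ ext g z) → (∀ z → ext F′ z ≡ ext F (t + z)) → d ∣ t
  over-g-translation t over over′ tr = FundamentalPeriod.divides-all (stab⇒fundamental hs d∣N)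
    (period λ z → trans (sym (over (t + z))) (trans (cong π (sym (tr z))) (over′ z)))

  -- f ∈ Map_[g] lies over a g; translating by n'·a undoes this.
  normalising-shift : MapOrb π N g → ℕ
  normalising-shift (_ , a , _) = n' * toℕ a

  -- The normal form of f ∈ Map_[g]: its translate lying over g itself.
  normal : MapOrb π N g → Fin N → Y
  normal x = act N (normalising-shift x) (proj₁ x)

  normal-over-g : ∀ x z → π (ext (normal x) z) ≡ ext g z
  normal-over-g (f , a , p) z = sym (ext-≐ (act-inverse g (toℕ a) p) z)

  normal-orbit : ∀ x → proj₁ x ≐ act N (n' * normalising-shift x) (normal x)
  normal-orbit x = act-inverse (proj₁ x) (normalising-shift x) (λ _ → refl)

  cut : MapOrb π N g → Prod π d e β
  cut x k j = ext (normal x) (point (toℕ k) j) , (begin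
    π (ext (normal x) (point (toℕ k) j))  ≡⟨ normal-over-g x (point (toℕ k) j) ⟩
    ext g (point (toℕ k) j)               ≡⟨ ext-g (point (toℕ k) j) ⟩
    β (col (point (toℕ k) j))             ≡⟨ cong β (col-point (toℕ k) j) ⟩
    β j                                   ∎)
    where open ≡-Reasoning

  glue : Prod π d e β → MapOrb π N g
  glue h = (λ b → proj₁ (h (row (toℕ b)) (col (toℕ b)))) ,
    zeroᶠ , λ b → trans (proj₂ (h _ _)) (sym (ext-g (toℕ b)))

  ext-glue : (h : Prod π d e β) (x : ℕ) → ext (proj₁ (glue h)) x ≡ proj₁ (h (row x) (col x))
  ext-glue h x = cong₂ (λ k j → proj₁ (h k j)) (row-mod-N x) (col-mod-N x)

  cut-resp : ∀ {x x′} → MapOrbRel π N g x x′ → ProdRel π d e β (cut x) (cut x′)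
  cut-resp {x@(f , a , _)} {x′@(f′ , a′ , _)} (c , p) =
    rotation (over-g-translation {normal x} {normal x′} t (normal-over-g x) (normal-over-g x′) shift-t)
    where
    open ≡-Reasoning
    s = normalising-shift x
    s′ = normalising-shift x′
    t = n' * s + (toℕ c + s′)
    shift-t : ∀ z → ext (normal x′) z ≡ ext (normal x) (t + z)
    shift-t z = begin
      ext (normal x′) z                             ≡⟨ ext-act f′ s′ z ⟩
      ext f′ (s′ + z)                               ≡⟨ ext-orbit f (toℕ c) p (s′ + z) ⟩
      ext f (toℕ c + (s′ + z))                      ≡⟨ ext-orbit (normal x) (n' * s) (normal-orbit x) _ ⟩
      ext (normal x) (n' * s + (toℕ c + (s′ + z)))  ≡⟨ cong (ext (normal x)) reassoc ⟩
      ext (normal x) (t + z)                        ∎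
      where
      reassoc : n' * s + (toℕ c + (s′ + z)) ≡ t + z
      reassoc = trans (cong (n' * s +_) (sym (+-assoc (toℕ c) s′ z)))
        (sym (+-assoc (n' * s) (toℕ c + s′) z))
    rotation : d ∣ t → ProdRel π d e β (cut x) (cut x′)
    rotation (divides q t≡qd) = q mod e , λ k j → begin
      ext (normal x′) (point (toℕ k) j)                         ≡⟨ shift-t (point (toℕ k) j) ⟩
      ext (normal x) (t + point (toℕ k) j)                      ≡⟨ cong (λ u → ext (normal x) (u + point (toℕ k) j)) t≡qd ⟩
      ext (normal x) (q * d + point (toℕ k) j)                  ≡⟨ ext-rotate (normal x) q k j ⟩
      ext (normal x) (point (toℕ (addℤ e (toℕ (q mod e)) k)) j) ∎

  glue-resp : ∀ {h h′} → ProdRel π d e β h h′ → MapOrbRel π N g (glue h) (glue h′)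
  glue-resp {h} {h′} (c , p) = (toℕ c * d) mod N , λ b →
    trans (p (row (toℕ b)) (col (toℕ b)))
      (cong₂ (λ k j → proj₁ (h k j)) (sym (row-translate (toℕ c) b)) (sym (col-translate (toℕ c) b)))

  glue-cut-normal : ∀ x → proj₁ (glue (cut x)) ≐ normal x
  glue-cut-normal x b = trans (ext-coords (normal x) (toℕ b)) (sym (ext-toℕ (normal x) b))

  glue-cut : ∀ x → MapOrbRel π N g (glue (cut x)) x
  glue-cut x = w mod N , λ b → trans (normal-orbit x b)
    (trans (sym (glue-cut-normal x (addℤ N w b))) (act-mod-period {G = proj₁ (glue (cut x))} period-N w b))
    where
    w = n' * normalising-shift x

  cut-glue : ∀ h → ProdRel π d e β (cut (glue h)) h
  cut-glue h = 0 mod e , λ k j → sym (begin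
    proj₁ (cut (glue h) (addℤ e (toℕ (0 mod e)) k) j)  ≡⟨ cong (λ k′ → proj₁ (cut (glue h) k′ j)) (rotate-zero k) ⟩
    ext (act N (n' * 0) G) (point (toℕ k) j)           ≡⟨ ext-act G (n' * 0) (point (toℕ k) j) ⟩
    ext G (n' * 0 + point (toℕ k) j)                   ≡⟨ cong (λ u → ext G (u + point (toℕ k) j)) (*-zeroʳ n') ⟩
    ext G (point (toℕ k) j)                            ≡⟨ ext-glue h (point (toℕ k) j) ⟩
    proj₁ (h (row (point (toℕ k) j)) (col (point (toℕ k) j)))
      ≡⟨ cong₂ (λ k′ j′ → proj₁ (h k′ j′)) (row-point k j) (col-point (toℕ k) j) ⟩
    proj₁ (h k j)                                      ∎)
    where
    open ≡-Reasoning
    G = proj₁ (glue h)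

  bijection : QuotBij (MapOrbRel π N g) (ProdRel π d e β)
  bijection = cut , glue , (λ {x} {y} → cut-resp {x} {y}) , (λ {h} {h′} → glue-resp {h} {h′}) ,
    glue-cut , cut-glue

-- Lemma 2.4 combines the two parts.
lemma2p4 : {Y : Set} {m : ℕ} (π : Y → Fin m) → (∀ i → ∃ λ y → π y ≡ i)
    → (n : ℕ) .{{_ : NonZero n}}
    → (Σ ((Fin n → Y) → Piece π n) λ ψ → IsQuotInverse (PieceRel π n) (Orb n) (incl π n) ψ)
      × ((d : ℕ) .{{_ : NonZero d}} → d ∣ n → (β : Fin d → Fin m)
          → HasStab n d (repeatβ n d β)
          → QuotBij (MapOrbRel π n (repeatβ n d β)) (ProdRel π d (n / d) β))
lemma2p4 π _ (suc n') = Decomposition.bijection π n' , λ d d∣n β hs → Blocks.bijection π n' d d∣n β hs
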